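{- Let $q$ be a prime power, $v\ge 1$, and let $G< P\Gamma L(v,q)$ be a group acting transitively on the set ${\mathbb{F}_q^v \brack 1}$ of $1$-dimensional subspaces of $\mathbb{F}_q^v$. Let $\alpha$ be a $1$-dimensional subspace of $\mathbb{F}_q^v$ and let $P=G_\alpha$ be its stabilizer in $G$. Let $\Delta=\bigcup_{i=1}^s \delta_i P$, where $\delta_1=\alpha$ and $\delta_1,\ldots,\delta_s$ are representatives of distinct $P$-orbits on ${\mathbb{F}_q^v \brack 1}$. Suppose that $\Delta$ is a subspace of $\mathbb{F}_q^v$ (i.e. $\Delta$ is exactly the set of all $1$-dimensional subspaces of some subspace of $\mathbb{F}_q^v$, which we identify with $\Delta$). Let $\mathcal{B}=\{\Delta g \mid g\in G\}$ (the set of blocks of the $q$-analog of a $1$-design with base block $\Delta$). If $$\{\alpha g : g\in G,\ \alpha g^{ -1}\in \Delta\}=\Delta,$$ then $\mathcal{B}$ is the set of neighborhoods of a $(\dim\Delta-1)$-regular $q$-ary graph $\mathcal{E}$ in $\mathbb{F}_q^v$, and $\mathcal{B}'=\{(\alpha g,\Delta g)\mid g\in G\}$ is the set of ordered pairs $(x,N_{\mathcal{E}}(x))$, $x\in {\mathbb{F}_q^v \brack 1}$. Moreover, $G$ acts as an automorphism group of $\mathcal{E}$, transitively on the $1$-dimensional subspaces of $\mathbb{F}_q^v$ and on the set of neighborhoods of $\mathcal{E}$.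
   Context: Groups act on the right: $xg$ denotes the image of $x$ under $g$, and for a set $X$ of subspaces $Xg=\{xg: x\in X\}$. $P\Gamma L(v,q)=\Gamma L(v,q)/C$ with $C$ the scalar maps; it acts faithfully on subspaces of $\mathbb{F}_q^v$. ${\mathbb{F}_q^v \brack k}$ denotes the set of $k$-dimensional subspaces of $\mathbb{F}_q^v$. A $q$-ary graph $\mathcal{E}$ in $\mathbb{F}_q^v$ is a pair $(V,E)$ with $V={\mathbb{F}_q^v \brack 1}$ (vertices) and $E\subseteq {\mathbb{F}_q^v \brack 2}$ (edges); vertices $x\neq y$ are adjacent if $x\oplus y\in E$. The neighborhood $N_{\mathcal{E}}(x)$ of a vertex $x$ is the set consisting of $x$ and all vertices adjacent to $x$. $\mathcal{E}$ is $k$-regular if for every vertex $x$, $N_{\mathcal{E}}(x)$ is (the set of $1$-subspaces of) a $(k+1)$-dimensional subspace. An automorphism of $\mathcal{E}$ is an element of $P\Gamma L(v,q)$ mapping edges to edges; an automorphism group is a group of such maps. -}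

module Defs where

open import Data.Nat using (ℕ; zero; suc; _^_)
open import Data.Nat.Primality using (Prime)
open import Data.Fin using (Fin)
import Data.Fin as Fin
open import Data.Vec using (Vec; replicate; zipWith; map)
open import Data.Product using (Σ; ∃; _×_; _,_; proj₁)
open import Data.Sum using (_⊎_)
open import Relation.Binary.PropositionalEquality using (_≡_; _≢_)
open import Relation.Nullary using (¬_)
open import Algebra.Structures using (IsCommutativeRing)
open import Function.Bundles using (_↔_; _⇔_)

IsPrimePower : ℕ → Set
IsPrimePower q = Σ ℕ λ p → Σ ℕ λ n → Prime p × q ≡ p ^ suc n

record FiniteField (q : ℕ) : Set₁ where
  field
    Carrier : Set
    _+_ _*_ : Carrier → Carrier → Carrier
    -_      : Carrier → Carrier
    0# 1#   : Carrier
    isCommutativeRing : IsCommutativeRing _≡_ _+_ _*_ -_ 0# 1#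
    0≢1     : 0# ≢ 1#
    inverse : ∀ x → x ≢ 0# → Σ Carrier λ y → x * y ≡ 1#
    enum    : Carrier ↔ Fin q

module _ {q : ℕ} (𝔽 : FiniteField q) (v : ℕ) where
  open FiniteField 𝔽

  V : Set
  V = Vec Carrier v

  0V : V
  0V = replicate v 0#

  _⊕_ : V → V → V
  _⊕_ = zipWith _+_

  _•_ : Carrier → V → V
  c • x = map (c *_) x

  NonZero : V → Set
  NonZero x = x ≢ 0V

  -- x and y span the same 1-dimensional subspace
  _~_ : V → V → Set
  x ~ y = Σ Carrier λ c → c ≢ 0# × x ≡ c • y

  record Subspace : Set₁ where
    field
      member : V → Set
      has0   : member 0V
      closed⊕ : ∀ {x y} → member x → member y → member (x ⊕ y)
      closed• : ∀ c {x} → member x → member (c • x)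
  open Subspace public

  lincomb : ∀ {d} → (Fin d → Carrier) → (Fin d → V) → V
  lincomb {zero}  c b = 0V
  lincomb {suc d} c b = (c Fin.zero • b Fin.zero) ⊕ lincomb (λ i → c (Fin.suc i)) (λ i → b (Fin.suc i))

  LinIndep : ∀ {d} → (Fin d → V) → Set
  LinIndep {d} b = ∀ (c : Fin d → Carrier) → lincomb c b ≡ 0V → ∀ i → c i ≡ 0#

  HasDim : Subspace → ℕ → Set
  HasDim S d = Σ (Fin d → V) λ b → LinIndep b ×
               (∀ w → member S w ⇔ Σ (Fin d → Carrier) λ c → w ≡ lincomb c b)

  Span2 : V → V → V → Set
  Span2 x y w = Σ Carrier λ a → Σ Carrier λ b → w ≡ (a • x) ⊕ (b • y)

  record SemilinearMap : Set where
    field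
      σ    : Carrier → Carrier
      σinv : Carrier → Carrier
      σ-+  : ∀ a b → σ (a + b) ≡ σ a + σ b
      σ-*  : ∀ a b → σ (a * b) ≡ σ a * σ b
      σinv-σ : ∀ a → σinv (σ a) ≡ a
      σ-σinv : ∀ a → σ (σinv a) ≡ a
      f    : V → V
      finv : V → V
      f-⊕  : ∀ x y → f (x ⊕ y) ≡ f x ⊕ f y
      f-•  : ∀ c x → f (c • x) ≡ σ c • f x
      finv-f : ∀ x → finv (f x) ≡ x
      f-finv : ∀ x → f (finv x) ≡ x
  open SemilinearMap public

  -- G is a subgroup of ΓL(v,q) (the preimage of a subgroup of PΓL(v,q));
  -- groups act on the right, x(gh) = (xg)h.
  IsSubgroup : (SemilinearMap → Set) → Set
  IsSubgroup G =
    (Σ SemilinearMap λ e → G e × (∀ x → f e x ≡ x)) ×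
    (∀ g h → G g → G h → Σ SemilinearMap λ k → G k × (∀ x → f k x ≡ f h (f g x))) ×
    (∀ g → G g → Σ SemilinearMap λ k → G k × (∀ x → f k x ≡ finv g x))

  IsQaryGraph : (Subspace → Set) → Set₁
  IsQaryGraph E = ∀ e → E e → HasDim e 2

  Adjacent : (Subspace → Set) → V → V → Set₁
  Adjacent E x y = ¬ (x ~ y) × Σ Subspace λ e → E e × (∀ w → member e w ⇔ Span2 x y w)

  Nbhd : (Subspace → Set) → V → V → Set₁
  Nbhd E x y = (y ~ x) ⊎ Adjacent E x y

  Regular : (Subspace → Set) → ℕ → Set₁
  Regular E k = ∀ x → NonZero x →
    Σ Subspace λ T → HasDim T (suc k) × (∀ y → NonZero y → Nbhd E x y ⇔ member T y)

  IsAutomorphism : (Subspace → Set) → SemilinearMap → Set₁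
  IsAutomorphism E g = ∀ e → E e →
    Σ Subspace λ e' → E e' × (∀ w → member e' w ⇔ member e (finv g w))

-- For a point x = αg let N(x) be the block Δg; it does not depend on the choice of g, because
-- the stabiliser G_α preserves Δ. The condition {αg : g ∈ G, αg⁻¹ ∈ Δ} ⊇ Δ makes blocks
-- symmetric: y ∈ N(x) iff x ∈ N(y). Call a line an edge when the block at each of its points
-- contains it. Since blocks are subspaces, symmetry shows that x and any y ∈ N(x) other than x
-- span an edge, while an edge through x lies in N(x); so N(x) is the neighbourhood of x, a
-- subspace of dimension dim Δ. As G maps the block at x to the block at xg, it permutes the
-- edges and is transitive on neighbourhoods.
module Submission where

open import Defs
open import Data.Nat using (ℕ; suc; _≤_; _∸_)
open import Data.Fin using (Fin; zero)
open import Data.Product using (Σ; _×_)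
open import Relation.Binary.PropositionalEquality using (_≡_; _≢_)
open import Relation.Nullary using (¬_)
open import Function.Bundles using (_⇔_)

open import Level using (0ℓ)
open import Algebra.Bundles using (CommutativeRing)
open import Algebra.Core using (Op₂)
open import Algebra.Morphism.Consequences using (homomorphic₂-inv)
import Algebra.Morphism.Definitions as MorphismDefinitions
import Algebra.Properties.CommutativeSemigroup as CommutativeSemigroupProperties
import Algebra.Properties.Ring as RingProperties
open import Data.Empty using (⊥-elim)
open import Data.Fin using (suc)
import Data.Fin.Properties as Fin
open import Data.Nat using (zero)
open import Data.Product using (_,_; proj₁; proj₂)
open import Data.Sum using (inj₁; inj₂)
open import Data.Vec using (Vec; []; _∷_; replicate; zipWith; map)
open import Data.Vec.Properties
  using ( map-id; map-cong; map-∘; map-const; map-replicate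
        ; zipWith-identityˡ; zipWith-identityʳ; ∷-injective; ≡-dec)
open import Function.Base using (_∘_)
open import Function.Bundles using (Inverse; Equivalence; mk⇔)
open import Function.Consequences.Propositional
  using (strictlyInverseˡ⇒inverseˡ; strictlyInverseʳ⇒inverseʳ)
open import Function.Definitions using (StrictlyInverseˡ; StrictlyInverseʳ)
open import Function.Properties.Inverse using (↔⇒↣)
import Function.Properties.Equivalence as ⇔
open import Relation.Binary.Definitions using (DecidableEquality)
open import Relation.Binary.PropositionalEquality
  using (refl; sym; trans; cong; cong₂; subst; module ≡-Reasoning)
open import Relation.Binary.PropositionalEquality.Algebra using (magma)
open import Relation.Nullary using (Dec; yes; no; ¬?)
import Relation.Nullary.Decidable as Dec
open import Relation.Nullary.Decidable using (via-injection; decidable-stable; _×-dec_)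

inverse-homomorphic : {A B : Set} {_∙_ : Op₂ A} {_∘′_ : Op₂ B} (h : A → B) (h⁻¹ : B → A) →
  StrictlyInverseˡ _≡_ h h⁻¹ → StrictlyInverseʳ _≡_ h h⁻¹ →
  MorphismDefinitions.Homomorphic₂ A B _≡_ h _∙_ _∘′_ →
  MorphismDefinitions.Homomorphic₂ B A _≡_ h⁻¹ _∘′_ _∙_
inverse-homomorphic {_∙_ = _∙_} {_∘′_} h h⁻¹ h-h⁻¹ h⁻¹-h =
  homomorphic₂-inv (magma _∙_) (magma _∘′_) (cong h⁻¹)
    (strictlyInverseˡ⇒inverseˡ h h-h⁻¹ , strictlyInverseʳ⇒inverseʳ h h⁻¹-h)

module FieldProperties {q : ℕ} (𝔽 : FiniteField q) where

  open FiniteField 𝔽 public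
    renaming (_+_ to infixl 6 _+_; _*_ to infixl 7 _*_; -_ to infix 8 -_)

  commutativeRing : CommutativeRing 0ℓ 0ℓ
  commutativeRing = record { isCommutativeRing = isCommutativeRing }

  open CommutativeRing commutativeRing public
    using ( +-identityˡ; +-identityʳ; *-assoc; *-comm; *-identityˡ
          ; distribˡ; distribʳ; zeroˡ; zeroʳ; ring; +-commutativeSemigroup)
  open RingProperties ring public using (x+x≈x⇒x≈0; -‿distribˡ-*; -‿distribʳ-*; +-inverseʳ-unique)
  open CommutativeSemigroupProperties +-commutativeSemigroup using (interchange)
  open ≡-Reasoning

  _≟_ : DecidableEquality Carrier
  _≟_ = via-injection (↔⇒↣ enum) Fin._≟_

  any? : {P : Carrier → Set} → (∀ c → Dec (P c)) → Dec (Σ Carrier P)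
  any? {P} P? =
    Dec.map (mk⇔ (λ (i , p) → from i , p) (λ (c , p) → to c , subst P (sym (strictlyInverseʳ c)) p))
            (Fin.any? (P? ∘ from))
    where open Inverse enum

  1≢0 : 1# ≢ 0#
  1≢0 1≡0 = 0≢1 (sym 1≡0)

  nonZero-invertible : ∀ {a} → a ≢ 0# → Σ Carrier λ b → b ≢ 0# × b * a ≡ 1#
  nonZero-invertible {a} a≢0 =
    let b , ab≡1 = inverse a a≢0
    in b , (λ b≡0 → 0≢1 (trans (sym (zeroʳ a)) (trans (cong (a *_) (sym b≡0)) ab≡1))) ,
       trans (*-comm b a) ab≡1

  *-nonZero : ∀ {a b} → a ≢ 0# → b ≢ 0# → a * b ≢ 0#
  *-nonZero {a} {b} a≢0 b≢0 ab≡0 =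
    let a⁻¹ , _ , a⁻¹a≡1 = nonZero-invertible a≢0
    in b≢0 (begin
      b             ≡⟨ *-identityˡ b ⟨
      1# * b        ≡⟨ cong (_* b) a⁻¹a≡1 ⟨
      a⁻¹ * a * b   ≡⟨ *-assoc a⁻¹ a b ⟩
      a⁻¹ * (a * b) ≡⟨ cong (a⁻¹ *_) ab≡0 ⟩
      a⁻¹ * 0#      ≡⟨ zeroʳ a⁻¹ ⟩
      0#            ∎)

  private variable n : ℕ

  -- Length-polymorphic versions of _⊕_, _•_ and 0V, which are fixed to length v.
  infixl 6 _⊞_
  infixr 7 _·_

  _⊞_ : Vec Carrier n → Vec Carrier n → Vec Carrier n
  _⊞_ = zipWith _+_

  _·_ : Carrier → Vec Carrier n → Vec Carrier n
  c · x = map (c *_) x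

  𝟎 : Vec Carrier n
  𝟎 = replicate _ 0#

  ⊞-identityˡ : (x : Vec Carrier n) → 𝟎 ⊞ x ≡ x
  ⊞-identityˡ = zipWith-identityˡ +-identityˡ

  ⊞-identityʳ : (x : Vec Carrier n) → x ⊞ 𝟎 ≡ x
  ⊞-identityʳ = zipWith-identityʳ +-identityʳ

  ·-identityˡ : (x : Vec Carrier n) → 1# · x ≡ x
  ·-identityˡ x = trans (map-cong *-identityˡ x) (map-id x)

  ·-assoc : ∀ a b (x : Vec Carrier n) → a · b · x ≡ (a * b) · x
  ·-assoc a b x = trans (sym (map-∘ (a *_) (b *_) x)) (map-cong (λ c → sym (*-assoc a b c)) x)

  ·-zeroˡ : (x : Vec Carrier n) → 0# · x ≡ 𝟎
  ·-zeroˡ x = trans (map-cong zeroˡ x) (map-const x 0#)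

  ·-zeroʳ : ∀ a → a · 𝟎 {n} ≡ 𝟎
  ·-zeroʳ {n} a = trans (map-replicate (a *_) 0# n) (cong (replicate n) (zeroʳ a))

  ·-solve : ∀ {a b} {x y : Vec Carrier n} → b * a ≡ 1# → a · x ≡ y → x ≡ b · y
  ·-solve {a = a} {b} {x} {y} ba≡1 ax≡y = begin
    x           ≡⟨ ·-identityˡ x ⟨
    1# · x      ≡⟨ cong (_· x) ba≡1 ⟨
    (b * a) · x ≡⟨ ·-assoc b a x ⟨
    b · a · x   ≡⟨ cong (b ·_) ax≡y ⟩
    b · y       ∎

  ·-cancel : ∀ {a} {x : Vec Carrier n} → a ≢ 0# → a · x ≡ 𝟎 → x ≡ 𝟎
  ·-cancel a≢0 ax≡0 =
    let a⁻¹ , _ , a⁻¹a≡1 = nonZero-invertible a≢0 in trans (·-solve a⁻¹a≡1 ax≡0) (·-zeroʳ a⁻¹)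

  combination-⊞ : ∀ a b a′ b′ (x y : Vec Carrier n) →
    (a · x ⊞ b · y) ⊞ (a′ · x ⊞ b′ · y) ≡ (a + a′) · x ⊞ (b + b′) · y
  combination-⊞ a b a′ b′ [] [] = refl
  combination-⊞ a b a′ b′ (u ∷ x) (w ∷ y) = cong₂ _∷_
    (trans (interchange (a * u) (b * w) (a′ * u) (b′ * w))
           (cong₂ _+_ (sym (distribʳ u a a′)) (sym (distribʳ w b b′))))
    (combination-⊞ a b a′ b′ x y)

  combination-· : ∀ c a b (x y : Vec Carrier n) → c · (a · x ⊞ b · y) ≡ (c * a) · x ⊞ (c * b) · y
  combination-· c a b [] [] = refl
  combination-· c a b (u ∷ x) (w ∷ y) = cong₂ _∷_
    (trans (distribˡ c (a * u) (b * w)) (cong₂ _+_ (sym (*-assoc c a u)) (sym (*-assoc c b w))))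
    (combination-· c a b x y)

  combination≡𝟎⇒dependent : ∀ {a b b′} (x y : Vec Carrier n) → b′ * b ≡ 1# →
    a · x ⊞ b · y ≡ 𝟎 → y ≡ (- (b′ * a)) · x
  combination≡𝟎⇒dependent [] [] _ _ = refl
  combination≡𝟎⇒dependent {a = a} {b} {b′} (u ∷ x) (w ∷ y) b′b≡1 au+bw∷ax+by≡0 =
    cong₂ _∷_ w≡ (combination≡𝟎⇒dependent x y b′b≡1 ax+by≡0)
    where
    au+bw≡0 : a * u + b * w ≡ 0#
    au+bw≡0 = proj₁ (∷-injective au+bw∷ax+by≡0)
    ax+by≡0 : a · x ⊞ b · y ≡ 𝟎
    ax+by≡0 = proj₂ (∷-injective au+bw∷ax+by≡0)
    w≡ : w ≡ - (b′ * a) * u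
    w≡ = begin
      w                ≡⟨ *-identityˡ w ⟨
      1# * w           ≡⟨ cong (_* w) b′b≡1 ⟨
      b′ * b * w       ≡⟨ *-assoc b′ b w ⟩
      b′ * (b * w)     ≡⟨ cong (b′ *_) (+-inverseʳ-unique (a * u) (b * w) au+bw≡0) ⟩
      b′ * - (a * u)   ≡⟨ -‿distribʳ-* b′ (a * u) ⟨
      - (b′ * (a * u)) ≡⟨ cong -_ (*-assoc b′ a u) ⟨
      - (b′ * a * u)   ≡⟨ -‿distribˡ-* (b′ * a) u ⟩
      - (b′ * a) * u   ∎

module Geometry {q : ℕ} (𝔽 : FiniteField q) (v : ℕ) where

  open FieldProperties 𝔽
  open ≡-Reasoning
  open Equivalence using (to; from)

  SL : Set
  SL = SemilinearMap 𝔽 v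

  NZ : V 𝔽 v → Set
  NZ = NonZero 𝔽 v

  infix 4 _≈_
  _≈_ : V 𝔽 v → V 𝔽 v → Set
  _≈_ = _~_ 𝔽 v

  private variable
    x y z : V 𝔽 v
    g h k : SL

  ≈-reflexive : x ≡ y → x ≈ y
  ≈-reflexive {y = y} refl = 1# , 1≢0 , sym (·-identityˡ y)

  ≈-sym : x ≈ y → y ≈ x
  ≈-sym (c , c≢0 , x≡cy) =
    let c⁻¹ , c⁻¹≢0 , c⁻¹c≡1 = nonZero-invertible c≢0 in c⁻¹ , c⁻¹≢0 , ·-solve c⁻¹c≡1 (sym x≡cy)

  ≈-trans : x ≈ y → y ≈ z → x ≈ z
  ≈-trans {z = z} (c , c≢0 , x≡cy) (d , d≢0 , y≡dz) =
    c * d , *-nonZero c≢0 d≢0 , trans x≡cy (trans (cong (c ·_) y≡dz) (·-assoc c d z))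

  _≈?_ : ∀ x y → Dec (x ≈ y)
  x ≈? y = any? (λ c → ¬? (c ≟ 0#) ×-dec ≡-dec _≟_ x (c · y))

  _⁻¹ : SL → SL
  g ⁻¹ = record
    { σ = σinv g ; σinv = σ g
    ; σ-+ = inverse-homomorphic (σ g) (σinv g) (σ-σinv g) (σinv-σ g) (σ-+ g)
    ; σ-* = inverse-homomorphic (σ g) (σinv g) (σ-σinv g) (σinv-σ g) (σ-* g)
    ; σinv-σ = σ-σinv g ; σ-σinv = σinv-σ g
    ; f = finv g ; finv = f g
    ; f-⊕ = inverse-homomorphic (f g) (finv g) (f-finv g) (finv-f g) (f-⊕ g)
    ; f-• = finv-•
    ; finv-f = f-finv g ; f-finv = finv-f g
    }
    where
    finv-• : ∀ c x → finv g (c · x) ≡ σinv g c · finv g x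
    finv-• c x = begin
      finv g (c · x)                            ≡⟨ cong (finv g) (cong₂ _·_ (σ-σinv g c) (f-finv g x)) ⟨
      finv g (σ g (σinv g c) · f g (finv g x)) ≡⟨ cong (finv g) (f-• g (σinv g c) (finv g x)) ⟨
      finv g (f g (σinv g c · finv g x))       ≡⟨ finv-f g _ ⟩
      σinv g c · finv g x                      ∎

  σ-0 : (g : SL) → σ g 0# ≡ 0#
  σ-0 g = x+x≈x⇒x≈0 (σ g 0#) (trans (sym (σ-+ g 0# 0#)) (cong (σ g) (+-identityʳ 0#)))

  σ-nonZero : (g : SL) → ∀ {c} → c ≢ 0# → σ g c ≢ 0#
  σ-nonZero g {c} c≢0 σc≡0 = c≢0 (trans (sym (σinv-σ g c)) (trans (cong (σinv g) σc≡0) (σ-0 (g ⁻¹))))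

  f-𝟎 : (g : SL) → f g 𝟎 ≡ 𝟎
  f-𝟎 g = begin
    f g 𝟎            ≡⟨ cong (f g) (·-zeroʳ 0#) ⟨
    f g (0# · 𝟎)     ≡⟨ f-• g 0# 𝟎 ⟩
    σ g 0# · f g 𝟎   ≡⟨ cong (_· f g 𝟎) (σ-0 g) ⟩
    0# · f g 𝟎       ≡⟨ ·-zeroˡ (f g 𝟎) ⟩
    𝟎                ∎

  f-nonZero : (g : SL) → NZ x → NZ (f g x)
  f-nonZero {x} g x≢0 fx≡0 = x≢0 (trans (sym (finv-f g x)) (trans (cong (finv g) fx≡0) (f-𝟎 (g ⁻¹))))

  finv-nonZero : (g : SL) → NZ x → NZ (finv g x)
  finv-nonZero g = f-nonZero (g ⁻¹)

  f-resp-≈ : (g : SL) → x ≈ y → f g x ≈ f g y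
  f-resp-≈ {y = y} g (c , c≢0 , x≡cy) = σ g c , σ-nonZero g c≢0 , trans (cong (f g) x≡cy) (f-• g c y)

  finv-resp-≈ : (g : SL) → x ≈ y → finv g x ≈ finv g y
  finv-resp-≈ g = f-resp-≈ (g ⁻¹)

  f≡⇒finv≡ : (g : SL) → f g x ≡ y → finv g y ≡ x
  f≡⇒finv≡ g fx≡y = trans (cong (finv g) (sym fx≡y)) (finv-f g _)

  finv-∘ : (∀ u → f k u ≡ f h (f g u)) → ∀ z → finv k z ≡ finv g (finv h z)
  finv-∘ {k} {h} {g} fk≡fh∘fg z =
    f≡⇒finv≡ k (trans (fk≡fh∘fg _) (trans (cong (f h) (f-finv g _)) (f-finv h z)))

  lincomb-cong : ∀ {d} (c : Fin d → Carrier) {b b′ : Fin d → V 𝔽 v} →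
    (∀ i → b i ≡ b′ i) → lincomb 𝔽 v c b ≡ lincomb 𝔽 v c b′
  lincomb-cong {zero} c b≗b′ = refl
  lincomb-cong {suc d} c b≗b′ =
    cong₂ _⊞_ (cong (c zero ·_) (b≗b′ zero)) (lincomb-cong (c ∘ suc) (b≗b′ ∘ suc))

  f-lincomb : (g : SL) → ∀ {d} (c : Fin d → Carrier) (b : Fin d → V 𝔽 v) →
    f g (lincomb 𝔽 v c b) ≡ lincomb 𝔽 v (σ g ∘ c) (f g ∘ b)
  f-lincomb g {zero} c b = f-𝟎 g
  f-lincomb g {suc d} c b =
    trans (f-⊕ g _ _) (cong₂ _⊞_ (f-• g (c zero) (b zero)) (f-lincomb g (c ∘ suc) (b ∘ suc)))

  finv-lincomb-f : (g : SL) → ∀ {d} (c : Fin d → Carrier) (b : Fin d → V 𝔽 v) →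
    finv g (lincomb 𝔽 v c (f g ∘ b)) ≡ lincomb 𝔽 v (σinv g ∘ c) b
  finv-lincomb-f g c b = trans (f-lincomb (g ⁻¹) c (f g ∘ b)) (lincomb-cong (σinv g ∘ c) (finv-f g ∘ b))

  image : SL → Subspace 𝔽 v → Subspace 𝔽 v
  image g T = record
    { member = member T ∘ finv g
    ; has0 = subst (member T) (sym (f-𝟎 (g ⁻¹))) (has0 T)
    ; closed⊕ = λ {x} {y} x∈ y∈ → subst (member T) (sym (f-⊕ (g ⁻¹) x y)) (closed⊕ T x∈ y∈)
    ; closed• = λ c {x} x∈ → subst (member T) (sym (f-• (g ⁻¹) c x)) (closed• T (σinv g c) x∈)
    }

  image-dim : ∀ g T {d} → HasDim 𝔽 v T d → HasDim 𝔽 v (image g T) d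
  image-dim g T {d} (b , b-independent , T∋⇔) = f g ∘ b , independent , λ w → mk⇔ (spanned w) (∈image w)
    where
    independent : LinIndep 𝔽 v (f g ∘ b)
    independent c comb≡0 i = begin
      c i                 ≡⟨ σ-σinv g (c i) ⟨
      σ g (σinv g (c i))  ≡⟨ cong (σ g) (b-independent (σinv g ∘ c) preimage≡0 i) ⟩
      σ g 0#              ≡⟨ σ-0 g ⟩
      0#                  ∎
      where
      preimage≡0 : lincomb 𝔽 v (σinv g ∘ c) b ≡ 𝟎
      preimage≡0 = trans (sym (finv-lincomb-f g c b)) (trans (cong (finv g) comb≡0) (f-𝟎 (g ⁻¹)))
    spanned : ∀ w → member T (finv g w) → Σ (Fin d → Carrier) λ c → w ≡ lincomb 𝔽 v c (f g ∘ b)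
    spanned w finv-w∈T =
      let c , finv-w≡ = to (T∋⇔ (finv g w)) finv-w∈T
      in σ g ∘ c , trans (sym (f-finv g w)) (trans (cong (f g) finv-w≡) (f-lincomb g c b))
    ∈image : ∀ w → (Σ (Fin d → Carrier) λ c → w ≡ lincomb 𝔽 v c (f g ∘ b)) → member T (finv g w)
    ∈image w (c , w≡) =
      from (T∋⇔ (finv g w)) (σinv g ∘ c , trans (cong (finv g) w≡) (finv-lincomb-f g c b))

  dim≡suc-pred : ∀ {T d} → HasDim 𝔽 v T d → member T x → NZ x → d ≡ suc (d ∸ 1)
  dim≡suc-pred {d = zero} (_ , _ , T∋⇔) x∈T x≢0 = ⊥-elim (x≢0 (proj₂ (to (T∋⇔ _) x∈T)))
  dim≡suc-pred {d = suc d} _ _ _ = refl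

  span : V 𝔽 v → V 𝔽 v → Subspace 𝔽 v
  span x y = record
    { member = Span2 𝔽 v x y
    ; has0 = 0# , 0# , sym (trans (cong₂ _⊞_ (·-zeroˡ x) (·-zeroˡ y)) (⊞-identityʳ 𝟎))
    ; closed⊕ = λ { (a , b , z≡) (a′ , b′ , z′≡) →
        a + a′ , b + b′ , trans (cong₂ _⊞_ z≡ z′≡) (combination-⊞ a b a′ b′ x y) }
    ; closed• = λ { c (a , b , z≡) → c * a , c * b , trans (cong (c ·_) z≡) (combination-· c a b x y) }
    }

  span-∋ˡ : ∀ x y → Span2 𝔽 v x y x
  span-∋ˡ x y = 1# , 0# , sym (trans (cong₂ _⊞_ (·-identityˡ x) (·-zeroˡ y)) (⊞-identityʳ x))

  span-∋ʳ : ∀ x y → Span2 𝔽 v x y y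
  span-∋ʳ x y = 0# , 1# , sym (trans (cong₂ _⊞_ (·-zeroˡ x) (·-identityˡ y)) (⊞-identityˡ y))

  span-⊆ : (T : Subspace 𝔽 v) → member T x → member T y → Span2 𝔽 v x y z → member T z
  span-⊆ T x∈T y∈T (a , b , z≡) =
    subst (member T) (sym z≡) (closed⊕ T (closed• T a x∈T) (closed• T b y∈T))

  independent-pair : NZ x → NZ y → ¬ y ≈ x → ∀ {a b} → a · x ⊞ b · y ≡ 𝟎 → a ≡ 0# × b ≡ 0#
  independent-pair {x} {y} x≢0 y≢0 y≉x {a} {b} ax+by≡0 = a≡0 , b≡0
    where
    b≡0 : b ≡ 0#
    b≡0 = decidable-stable (b ≟ 0#) λ b≢0 →
      let b⁻¹ , _ , b⁻¹b≡1 = nonZero-invertible b≢0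
          y≡ = combination≡𝟎⇒dependent x y b⁻¹b≡1 ax+by≡0
          coefficient≢0 = λ c≡0 → y≢0 (trans y≡ (trans (cong (_· x) c≡0) (·-zeroˡ x)))
      in y≉x (- (b⁻¹ * a) , coefficient≢0 , y≡)
    a≡0 : a ≡ 0#
    a≡0 = decidable-stable (a ≟ 0#) λ a≢0 → x≢0 (·-cancel a≢0 (begin
      a · x            ≡⟨ ⊞-identityʳ (a · x) ⟨
      a · x ⊞ 𝟎        ≡⟨ cong (a · x ⊞_) (trans (cong (_· y) b≡0) (·-zeroˡ y)) ⟨
      a · x ⊞ b · y    ≡⟨ ax+by≡0 ⟩
      𝟎                ∎))

  span-dim : NZ x → NZ y → ¬ y ≈ x → HasDim 𝔽 v (span x y) 2
  span-dim {x} {y} x≢0 y≢0 y≉x = basis , independent , λ w → mk⇔ (coordinates w) (combination w)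
    where
    basis : Fin 2 → V 𝔽 v
    basis zero = x
    basis (suc _) = y
    lincomb≡ : ∀ c → lincomb 𝔽 v c basis ≡ c zero · x ⊞ c (suc zero) · y
    lincomb≡ c = cong (c zero · x ⊞_) (⊞-identityʳ (c (suc zero) · y))
    independent : LinIndep 𝔽 v basis
    independent c comb≡0 zero = proj₁ (independent-pair x≢0 y≢0 y≉x (trans (sym (lincomb≡ c)) comb≡0))
    independent c comb≡0 (suc zero) =
      proj₂ (independent-pair x≢0 y≢0 y≉x (trans (sym (lincomb≡ c)) comb≡0))
    coordinates : ∀ w → Span2 𝔽 v x y w → Σ (Fin 2 → Carrier) λ c → w ≡ lincomb 𝔽 v c basis
    coordinates w (a , b , w≡) = c , trans w≡ (sym (lincomb≡ c))
      where
      c : Fin 2 → Carrier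
      c zero = a
      c (suc _) = b
    combination : ∀ w → (Σ (Fin 2 → Carrier) λ c → w ≡ lincomb 𝔽 v c basis) → Span2 𝔽 v x y w
    combination w (c , w≡) = c zero , c (suc zero) , trans w≡ (lincomb≡ c)

module BaseBlock {q : ℕ} {𝔽 : FiniteField q} {v : ℕ}
  (G : SemilinearMap 𝔽 v → Set) (G-subgroup : IsSubgroup 𝔽 v G)
  (G-transitive : ∀ x y → NonZero 𝔽 v x → NonZero 𝔽 v y →
     Σ (SemilinearMap 𝔽 v) λ g → G g × _~_ 𝔽 v (f g x) y)
  (α : V 𝔽 v) (α≢0 : NonZero 𝔽 v α)
  {s : ℕ} (δ : Fin (suc s) → V 𝔽 v) (δ₀≡α : δ zero ≡ α) where

  open Geometry 𝔽 v
  open Equivalence using (to; from)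

  private variable
    u w x y z : V 𝔽 v
    g h p : SL

  G-identity : Σ SL λ e → G e × (∀ x → f e x ≡ x)
  G-identity = proj₁ G-subgroup

  G-∘ : G g → G h → Σ SL λ k → G k × (∀ x → f k x ≡ f h (f g x))
  G-∘ = proj₁ (proj₂ G-subgroup) _ _

  G-⁻¹ : G g → Σ SL λ k → G k × (∀ x → f k x ≡ finv g x)
  G-⁻¹ = proj₂ (proj₂ G-subgroup) _

  G-solve : G g → G h → Σ SL λ k → G k × (∀ x → f k (f g x) ≡ f h x)
  G-solve {g} {h} Gg Gh =
    let g′ , Gg′ , fg′≡finv-g = G-⁻¹ Gg
        k , Gk , fk≡ = G-∘ Gg′ Gh
    in k , Gk , λ x → trans (fk≡ _) (cong (f h) (trans (fg′≡finv-g _) (finv-f g x)))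

  point-of : NZ x → Σ SL λ g → G g × x ≈ f g α
  point-of x≢0 = let g , Gg , αg≈x = G-transitive _ _ α≢0 x≢0 in g , Gg , ≈-sym αg≈x

  Stabilizer : SL → Set
  Stabilizer p = G p × f p α ≈ α

  Δ : V 𝔽 v → Set
  Δ x = Σ (Fin (suc s)) λ i → Σ SL λ p → Stabilizer p × x ≈ f p (δ i)

  infix 4 _∈Δ_
  _∈Δ_ : V 𝔽 v → SL → Set
  y ∈Δ g = Δ (finv g y)

  α∈Δ : Δ α
  α∈Δ = let e , Ge , e-id = G-identity
        in zero , e , (Ge , ≈-reflexive (e-id α)) , ≈-reflexive (sym (trans (cong (f e) δ₀≡α) (e-id α)))

  Δ-resp-≈ : u ≈ w → Δ w → Δ u
  Δ-resp-≈ u≈w (i , p , p∈P , w≈) = i , p , p∈P , ≈-trans u≈w w≈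

  ∈Δ-resp-≈ : ∀ g → u ≈ w → w ∈Δ g → u ∈Δ g
  ∈Δ-resp-≈ g u≈w = Δ-resp-≈ (finv-resp-≈ g u≈w)

  Δ-stable : Stabilizer p → Δ u → Δ (f p u)
  Δ-stable {p} {u} (Gp , αp≈α) (i , p₀ , (Gp₀ , αp₀≈α) , u≈) =
    let k , Gk , fk≡ = G-∘ Gp₀ Gp
    in i , k , (Gk , subst (_≈ α) (sym (fk≡ α)) (≈-trans (f-resp-≈ p αp₀≈α) αp≈α))
         , subst (f p u ≈_) (sym (fk≡ (δ i))) (f-resp-≈ p u≈)

  point∈block : ∀ g → x ≈ f g α → x ∈Δ g
  point∈block g x≈αg = Δ-resp-≈ (subst (_ ≈_) (finv-f g α) (finv-resp-≈ g x≈αg)) α∈Δ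

  block-cong : G g → G h → f g α ≈ f h α → y ∈Δ g → y ∈Δ h
  block-cong {g} {h} {y} Gg Gh αg≈αh y∈Δg =
    let h′ , Gh′ , fh′≡finv-h = G-⁻¹ Gh
        p , Gp , fp≡ = G-∘ Gg Gh′
        fp≡finv-h∘fg = λ u → trans (fp≡ u) (fh′≡finv-h (f g u))
        αp≈α = subst (_≈ α) (sym (fp≡finv-h∘fg α))
                 (subst (finv h (f g α) ≈_) (finv-f h α) (finv-resp-≈ h αg≈αh))
    in subst Δ (trans (fp≡finv-h∘fg _) (cong (finv h) (f-finv g y))) (Δ-stable (Gp , αp≈α) y∈Δg)

  module Graph (S : Subspace 𝔽 v) (S⇔Δ : ∀ x → NZ x → member S x ⇔ Δ x)
           (Δ-symmetric : ∀ x → NZ x → Δ x → Σ SL λ g → G g × x ≈ f g α × Δ (finv g α)) where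

    ∈Δ⇔∈image : ∀ g → NZ y → y ∈Δ g ⇔ member (image g S) y
    ∈Δ⇔∈image g y≢0 = ⇔.sym (S⇔Δ _ (finv-nonZero g y≢0))

    ∈Δ-span : ∀ g → NZ x → NZ y → NZ z → x ∈Δ g → y ∈Δ g → Span2 𝔽 v x y z → z ∈Δ g
    ∈Δ-span g x≢0 y≢0 z≢0 x∈Δg y∈Δg z∈xy = from (∈Δ⇔∈image g z≢0)
      (span-⊆ (image g S) (to (∈Δ⇔∈image g x≢0) x∈Δg) (to (∈Δ⇔∈image g y≢0) y∈Δg) z∈xy)

    block-sym : G g → G h → w ≈ f g α → z ≈ f h α → NZ z → z ∈Δ g → w ∈Δ h
    block-sym {g} {h} {w} {z} Gg Gh w≈αg z≈αh z≢0 z∈Δg =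
      let g′ , Gg′ , zg⁻¹≈αg′ , αg′⁻¹∈Δ = Δ-symmetric _ (finv-nonZero g z≢0) z∈Δg
          k , Gk , fk≡ = G-∘ Gg′ Gg
          αk≈αh = subst (_≈ f h α) (sym (fk≡ α))
                    (≈-trans (≈-sym (subst (_≈ f g (f g′ α)) (f-finv g z) (f-resp-≈ g zg⁻¹≈αg′))) z≈αh)
          αg∈Δk = subst Δ (sym (trans (finv-∘ {k} {g} {g′} fk≡ (f g α)) (cong (finv g′) (finv-f g α))))
                    αg′⁻¹∈Δ
      in ∈Δ-resp-≈ h w≈αg (block-cong Gk Gh αk≈αh αg∈Δk)

    infix 4 _∈block-of_
    _∈block-of_ : V 𝔽 v → V 𝔽 v → Set
    z ∈block-of w = Σ SL λ h → G h × w ≈ f h α × z ∈Δ h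

    edges : Subspace 𝔽 v → Set
    edges e = HasDim 𝔽 v e 2 × (∀ w z → member e w → member e z → NZ w → NZ z → z ∈block-of w)

    -- Every block at a point w of the line xy contains x and y: by the symmetry of blocks,
    -- since w lies in the blocks at x and at y.
    span-edge : G g → x ≈ f g α → NZ x → NZ y → ¬ y ≈ x → y ∈Δ g → edges (span x y)
    span-edge {g} {x} {y} Gg x≈αg x≢0 y≢0 y≉x y∈Δg = span-dim x≢0 y≢0 y≉x , λ w z w∈xy z∈xy w≢0 z≢0 →
      let h , Gh , w≈αh = point-of w≢0
          k , Gk , y≈αk = point-of y≢0
          x∈Δh = block-sym Gg Gh x≈αg w≈αh w≢0
                   (∈Δ-span g x≢0 y≢0 w≢0 (point∈block g x≈αg) y∈Δg w∈xy)
          x∈Δk = block-sym Gg Gk x≈αg y≈αk y≢0 y∈Δg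
          y∈Δh = block-sym Gk Gh y≈αk w≈αh w≢0
                   (∈Δ-span k x≢0 y≢0 w≢0 x∈Δk (point∈block k y≈αk) w∈xy)
      in h , Gh , w≈αh , ∈Δ-span h x≢0 y≢0 z≢0 x∈Δh y∈Δh z∈xy

    nbhd⇔block : G g → x ≈ f g α → NZ x → NZ y → Nbhd 𝔽 v edges x y ⇔ y ∈Δ g
    nbhd⇔block {g} {x} {y} Gg x≈αg x≢0 y≢0 = mk⇔ nbhd⇒block block⇒nbhd
      where
      nbhd⇒block : Nbhd 𝔽 v edges x y → y ∈Δ g
      nbhd⇒block (inj₁ y≈x) = point∈block g (≈-trans y≈x x≈αg)
      nbhd⇒block (inj₂ (_ , e , (_ , e-blocks) , e⇔xy)) =
        let x∈e = from (e⇔xy x) (span-∋ˡ x y)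
            y∈e = from (e⇔xy y) (span-∋ʳ x y)
            h , Gh , x≈αh , y∈Δh = e-blocks x y x∈e y∈e x≢0 y≢0
        in block-cong Gh Gg (≈-trans (≈-sym x≈αh) x≈αg) y∈Δh
      block⇒nbhd : y ∈Δ g → Nbhd 𝔽 v edges x y
      block⇒nbhd y∈Δg with y ≈? x
      ... | yes y≈x = inj₁ y≈x
      ... | no y≉x = inj₂ (y≉x ∘ ≈-sym , span x y , span-edge Gg x≈αg x≢0 y≢0 y≉x y∈Δg , λ _ → ⇔.refl)

    nbhd-of-point : NZ x → Σ SL λ g → G g × x ≈ f g α × (∀ y → NZ y → Nbhd 𝔽 v edges x y ⇔ y ∈Δ g)
    nbhd-of-point x≢0 = let g , Gg , x≈αg = point-of x≢0
                        in g , Gg , x≈αg , λ y y≢0 → nbhd⇔block Gg x≈αg x≢0 y≢0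

    nbhd-of-image : G g → Σ (V 𝔽 v) λ x → NZ x × x ≈ f g α × (∀ y → NZ y → Nbhd 𝔽 v edges x y ⇔ y ∈Δ g)
    nbhd-of-image {g} Gg = f g α , f-nonZero g α≢0 , ≈-reflexive refl ,
                           λ y y≢0 → nbhd⇔block Gg (≈-reflexive refl) (f-nonZero g α≢0) y≢0

    regular : ∀ {d} → HasDim 𝔽 v S d → Regular 𝔽 v edges (d ∸ 1)
    regular S-dim x x≢0 =
      let g , Gg , x≈αg = point-of x≢0
          d≡ = dim≡suc-pred {T = S} S-dim (from (S⇔Δ α α≢0) α∈Δ) α≢0
      in image g S , subst (HasDim 𝔽 v (image g S)) d≡ (image-dim g S S-dim) ,
         λ y y≢0 → ⇔.trans (nbhd⇔block Gg x≈αg x≢0 y≢0) (∈Δ⇔∈image g y≢0)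

    ∈block-of-image : G g → finv g z ∈block-of finv g w → z ∈block-of w
    ∈block-of-image {g} {z} {w} Gg (h , Gh , wg⁻¹≈αh , zg⁻¹∈Δh) =
      let k , Gk , fk≡ = G-∘ Gh Gg
      in k , Gk ,
         subst (_≈ f k α) (f-finv g w) (subst (f g (finv g w) ≈_) (sym (fk≡ α)) (f-resp-≈ g wg⁻¹≈αh)) ,
         subst Δ (sym (finv-∘ {k} {g} {h} fk≡ z)) zg⁻¹∈Δh

    G-automorphism : G g → IsAutomorphism 𝔽 v edges g
    G-automorphism {g} Gg e (e-dim , e-blocks) =
      image g e ,
      (image-dim g e e-dim , λ w z w∈ z∈ w≢0 z≢0 →
         ∈block-of-image Gg (e-blocks _ _ w∈ z∈ (finv-nonZero g w≢0) (finv-nonZero g z≢0))) ,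
      λ _ → ⇔.refl

    nbhd-transitive : NZ x → NZ y → Σ SL λ g → G g ×
      (∀ z → NZ z → Nbhd 𝔽 v edges x (finv g z) ⇔ Nbhd 𝔽 v edges y z)
    nbhd-transitive {x} {y} x≢0 y≢0 =
      let a , Ga , _ , Nx⇔Δa = nbhd-of-point x≢0
          b , Gb , _ , Ny⇔Δb = nbhd-of-point y≢0
          g , Gg , fg∘fa≡fb = G-solve Ga Gb
          finv-a∘finv-g≡finv-b = λ z → sym (finv-∘ {b} {g} {a} (sym ∘ fg∘fa≡fb) z)
      in g , Gg , λ z z≢0 →
           ⇔.trans (subst (λ u → Nbhd 𝔽 v edges x (finv g z) ⇔ Δ u) (finv-a∘finv-g≡finv-b z)
                          (Nx⇔Δa _ (finv-nonZero g z≢0)))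
                   (⇔.sym (Ny⇔Δb z z≢0))

theorem3 : {q : ℕ} → IsPrimePower q → (𝔽 : FiniteField q) → (v : ℕ) → 1 ≤ v →
  (G : SemilinearMap 𝔽 v → Set) → IsSubgroup 𝔽 v G →
  -- G transitive on 1-subspaces
  (∀ x y → NonZero 𝔽 v x → NonZero 𝔽 v y →
     Σ (SemilinearMap 𝔽 v) λ g → G g × _~_ 𝔽 v (f g x) y) →
  (α : V 𝔽 v) → NonZero 𝔽 v α →
  (s : ℕ) → (δ : Fin (suc s) → V 𝔽 v) → (∀ i → NonZero 𝔽 v (δ i)) → δ zero ≡ α →
  -- distinct orbits of P = G_α
  (∀ i j → i ≢ j → ¬ (Σ (SemilinearMap 𝔽 v) λ p → (G p × _~_ 𝔽 v (f p α) α) ×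
                                 _~_ 𝔽 v (δ i) (f p (δ j)))) →
  let Δ : V 𝔽 v → Set
      Δ x = Σ (Fin (suc s)) λ i → Σ (SemilinearMap 𝔽 v) λ p →
              (G p × _~_ 𝔽 v (f p α) α) × _~_ 𝔽 v x (f p (δ i))
  in
  -- Δ is a subspace S
  (S : Subspace 𝔽 v) → (∀ x → NonZero 𝔽 v x → (member S x ⇔ Δ x)) →
  -- {α g : g ∈ G, α g⁻¹ ∈ Δ} = Δ
  (∀ x → NonZero 𝔽 v x →
     ((Σ (SemilinearMap 𝔽 v) λ g → G g × _~_ 𝔽 v x (f g α) × Δ (finv g α)) ⇔ Δ x)) →
  (d : ℕ) → HasDim 𝔽 v S d →
  Σ (Subspace 𝔽 v → Set) λ E →
    IsQaryGraph 𝔽 v E ×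
    Regular 𝔽 v E (d ∸ 1) ×
    -- B = {Δ g : g ∈ G} is the set of neighborhoods
    ((∀ g → G g → Σ (V 𝔽 v) λ x → NonZero 𝔽 v x ×
        (∀ y → NonZero 𝔽 v y → (Nbhd 𝔽 v E x y ⇔ Δ (finv g y)))) ×
     (∀ x → NonZero 𝔽 v x → Σ (SemilinearMap 𝔽 v) λ g → G g ×
        (∀ y → NonZero 𝔽 v y → (Nbhd 𝔽 v E x y ⇔ Δ (finv g y))))) ×
    -- B' = {(α g, Δ g) : g ∈ G} = {(x, N(x))}
    ((∀ g → G g → Σ (V 𝔽 v) λ x → NonZero 𝔽 v x × _~_ 𝔽 v x (f g α) ×
        (∀ y → NonZero 𝔽 v y → (Nbhd 𝔽 v E x y ⇔ Δ (finv g y)))) ×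
     (∀ x → NonZero 𝔽 v x → Σ (SemilinearMap 𝔽 v) λ g → G g × _~_ 𝔽 v x (f g α) ×
        (∀ y → NonZero 𝔽 v y → (Nbhd 𝔽 v E x y ⇔ Δ (finv g y))))) ×
    -- G is an automorphism group of E
    (∀ g → G g → IsAutomorphism 𝔽 v E g) ×
    -- transitive on 1-subspaces
    (∀ x y → NonZero 𝔽 v x → NonZero 𝔽 v y →
       Σ (SemilinearMap 𝔽 v) λ g → G g × _~_ 𝔽 v (f g x) y) ×
    -- transitive on neighborhoods: N(x) g = N(y)
    (∀ x y → NonZero 𝔽 v x → NonZero 𝔽 v y →
       Σ (SemilinearMap 𝔽 v) λ g → G g ×
         (∀ z → NonZero 𝔽 v z → (Nbhd 𝔽 v E x (finv g z) ⇔ Nbhd 𝔽 v E y z)))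
theorem3 _ 𝔽 v _ G G-subgroup G-transitive α α≢0 s δ _ δ₀≡α _ S S⇔Δ Δ-condition d S-dim =
  edges , (λ _ → proj₁) , regular S-dim ,
  ((λ _ Gg → let x , x≢0 , _ , Nx⇔Δg = nbhd-of-image Gg in x , x≢0 , Nx⇔Δg) ,
   (λ _ x≢0 → let g , Gg , _ , Nx⇔Δg = nbhd-of-point x≢0 in g , Gg , Nx⇔Δg)) ,
  ((λ _ → nbhd-of-image) , (λ _ → nbhd-of-point)) ,
  (λ _ → G-automorphism) ,
  G-transitive ,
  (λ _ _ → nbhd-transitive)
  where
  open BaseBlock G G-subgroup G-transitive α α≢0 δ δ₀≡α
  open Graph S S⇔Δ (λ x x≢0 → Equivalence.from (Δ-condition x x≢0))
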